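{- Suppose that $G$ is an $n$-vertex triangle-free (i.e., $K_3$-free) graph satisfying $$\delta(G) > \min\left\{ \frac{n}{2} - \frac{\Delta(G)}{4},~ n - \Delta(G) - 1 \right\}.$$ Then $G$ is bipartite.
   Context: All graphs are finite and simple. $\delta(G)$ and $\Delta(G)$ denote the minimum and maximum degree of $G$. -}

module Defs where

open import Data.Nat using (ℕ; zero; suc; _+_; _⊔_; _⊓_)
open import Data.Fin using (Fin)
open import Data.Bool using (Bool; true; false)
open import Data.List using (List; []; _∷_; length; filter; map; foldr)
open import Data.List using (allFin)
open import Relation.Nullary using (¬_; Dec)
open import Relation.Binary using (Decidable)
open import Relation.Binary.PropositionalEquality using (_≡_; _≢_)
open import Data.Empty using (⊥)
open import Data.Product using (Σ)

record Graph (n : ℕ) : Set₁ where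
  field
    Adj    : Fin n → Fin n → Set
    adj?   : Decidable Adj
    sym    : ∀ {u v} → Adj u v → Adj v u
    irrefl : ∀ {u} → ¬ Adj u u

open Graph public

degree : ∀ {n} (G : Graph n) → Fin n → ℕ
degree {n} G v = length (filter (adj? G v) (allFin n))

Δ : ∀ {n} → Graph n → ℕ
Δ {zero}  G = 0
Δ {suc n} G = foldr _⊔_ 0 (map (degree G) (allFin (suc n)))

δ : ∀ {n} → Graph n → ℕ
δ {zero}  G = 0
δ {suc n} G = foldr _⊓_ (degree G Data.Fin.zero) (map (degree G) (allFin (suc n)))

TriangleFree : ∀ {n} → Graph n → Set
TriangleFree {n} G = ∀ (u v w : Fin n) → Adj G u v → Adj G v w → Adj G u w → ⊥

Bipartite : ∀ {n} → Graph n → Set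
Bipartite {n} G = Σ (Fin n → Bool) (λ c → ∀ u v → Adj G u v → c u ≢ c v)

{-# OPTIONS --safe #-}
module Submission where

-- Fix a vertex x of maximum degree and colour every vertex by whether a walk of length 2
-- joins it to x.  If both ends of an edge uv are joined to x in this way, through a and b,
-- then x a u v b is a closed 5-walk; in a triangle-free graph no vertex is adjacent to two
-- consecutive vertices of it, hence to more than two of them, so Δ + 4δ ≤ 2n.  Moreover
-- N(x) and N(a) are disjoint and both miss v, so Δ + δ < n.  If neither end is joined to x,
-- then N(x), N(u), N(v) are pairwise disjoint and all miss x, so Δ + 2δ < n.  Each of these
-- contradicts the degree condition.

open import Defs
open import Data.Nat using (ℕ; _+_; _*_; _<_)
open import Data.Sum using (_⊎_)

open import Algebra.Properties.CommutativeSemigroup using (interchange)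
open import Data.Bool using (if_then_else_)
open import Data.Empty using (⊥; ⊥-elim)
open import Data.Fin using (Fin)
open import Data.Fin.Properties using (any?)
open import Data.List using (List; []; _∷_; _++_; map; filter; length; allFin)
open import Data.List.Membership.Propositional using (_∈_)
open import Data.List.Membership.Propositional.Properties
  using (∈-allFin; ∈-map⁺; ∈-map⁻; foldr-selective)
open import Data.List.Properties using (map-cong; map-++; length-tabulate; foldr-forcesᵇ)
open import Data.List.Relation.Unary.All as All using (All; []; _∷_)
open import Data.List.Relation.Unary.AllPairs using (AllPairs; []; _∷_)
open import Data.List.Relation.Unary.Any using (here; there)
open import Data.Nat using (zero; suc; _≤_; z≤n; s≤s)
open import Data.Nat.ListAction using (sum)
open import Data.Nat.ListAction.Properties using (sum-++)
open import Data.Nat.Properties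
open import Data.Nat.Tactic.RingSolver using (solve-∀)
open import Data.Product using (∃-syntax; _×_; _,_)
open import Data.Sum using (inj₁; inj₂)
open import Function using (_∘_; id)
open import Relation.Binary using (Decidable)
open import Relation.Nullary using (Dec; yes; no; does; ¬_; contradiction)
open import Relation.Nullary.Decidable using (_×-dec_)
open import Relation.Binary.PropositionalEquality as ≡
  using (_≡_; _≢_; refl; cong; module ≡-Reasoning)

𝟙 : ∀ {p} {P : Set p} → Dec P → ℕ
𝟙 P? = if does P? then 1 else 0

does-≢ : ∀ {p q} {P : Set p} {Q : Set q} (P? : Dec P) (Q? : Dec Q) →
         (P → Q → ⊥) → (¬ P → ¬ Q → ⊥) → does P? ≢ does Q?
does-≢ (yes p) (yes q) both _       _  = both p q
does-≢ (no ¬p) (no ¬q) _    neither _  = neither ¬p ¬q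
does-≢ (yes _) (no _)  _    _       ()
does-≢ (no _)  (yes _) _    _       ()

module _ {a} {A : Set a} where

  length-filter≡sum-𝟙 : ∀ {p} {P : A → Set p} (P? : ∀ x → Dec (P x)) xs →
                        length (filter P? xs) ≡ sum (map (𝟙 ∘ P?) xs)
  length-filter≡sum-𝟙 P? []       = refl
  length-filter≡sum-𝟙 P? (x ∷ xs) with P? x
  ... | yes _ = cong suc (length-filter≡sum-𝟙 P? xs)
  ... | no  _ = length-filter≡sum-𝟙 P? xs

  sum-map-const : ∀ c (xs : List A) → sum (map (λ _ → c) xs) ≡ length xs * c
  sum-map-const c []       = refl
  sum-map-const c (_ ∷ xs) = cong (c +_) (sum-map-const c xs)

  sum-map-+ : ∀ (f g : A → ℕ) xs →
              sum (map (λ x → f x + g x) xs) ≡ sum (map f xs) + sum (map g xs)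
  sum-map-+ f g []       = refl
  sum-map-+ f g (x ∷ xs) = ≡.trans (cong (f x + g x +_) (sum-map-+ f g xs))
                                   (interchange +-commutativeSemigroup (f x) (g x) _ _)

  sum-map-mono-≤ : ∀ {f g : A → ℕ} → (∀ x → f x ≤ g x) → ∀ xs →
                   sum (map f xs) ≤ sum (map g xs)
  sum-map-mono-≤ f≤g []       = z≤n
  sum-map-mono-≤ f≤g (x ∷ xs) = +-mono-≤ (f≤g x) (sum-map-mono-≤ f≤g xs)

  sum-map-mono-< : ∀ {f g : A → ℕ} → (∀ x → f x ≤ g x) → ∀ {x xs} → x ∈ xs → f x < g x →
                   sum (map f xs) < sum (map g xs)
  sum-map-mono-< f≤g {xs = _ ∷ xs} (here refl)  fx<gx =
    +-mono-<-≤ fx<gx (sum-map-mono-≤ f≤g xs)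
  sum-map-mono-< f≤g {xs = y ∷ _}  (there x∈xs) fx<gx =
    +-mono-≤-< (f≤g y) (sum-map-mono-< f≤g x∈xs fx<gx)

sum-map-comm : ∀ {a b} {A : Set a} {B : Set b} (f : A → B → ℕ) xs ys →
               sum (map (λ x → sum (map (f x) ys)) xs) ≡
               sum (map (λ y → sum (map (λ x → f x y) xs)) ys)
sum-map-comm f []       ys = ≡.sym (≡.trans (sum-map-const 0 ys) (*-zeroʳ (length ys)))
sum-map-comm f (x ∷ xs) ys = ≡.trans (cong (sum (map (f x) ys) +_) (sum-map-comm f xs ys))
                                     (≡.sym (sum-map-+ (f x) _ ys))

maxDegreeVertex : ∀ {m} (G : Graph (suc m)) → ∃[ x ] Δ G ≤ degree G x
maxDegreeVertex G with foldr-selective ⊔-sel 0 (map (degree G) (allFin _))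
... | inj₁ Δ≡0 = Data.Fin.zero , ≤-trans (≤-reflexive Δ≡0) z≤n
... | inj₂ Δ∈degrees with ∈-map⁻ (degree G) Δ∈degrees
...   | x , _ , Δ≡degree = x , ≤-reflexive Δ≡degree

δ≤degree : ∀ {n} (G : Graph n) v → δ G ≤ degree G v
δ≤degree {suc n} G v = All.lookup δ≤degrees (∈-map⁺ (degree G) (∈-allFin v))
  where
  δ≤degrees : All (δ G ≤_) (map (degree G) (allFin (suc n)))
  δ≤degrees = foldr-forcesᵇ (λ d e δ≤d⊓e → m≤n⊓o⇒m≤n d e δ≤d⊓e , m≤n⊓o⇒m≤o d e δ≤d⊓e)
                            _ _ ≤-refl

Walk₂ : ∀ {n} → Graph n → Fin n → Fin n → Set
Walk₂ G u v = ∃[ w ] Adj G u w × Adj G w v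

walk₂? : ∀ {n} (G : Graph n) → Decidable (Walk₂ G)
walk₂? G u v = any? (λ w → adj? G u w ×-dec adj? G w v)

module _ {n} (G : Graph n) where

  DisjointNeighbourhoods : List (Fin n) → Set
  DisjointNeighbourhoods = AllPairs (λ s t → ¬ Walk₂ G s t)

  adjCount : List (Fin n) → Fin n → ℕ
  adjCount vs w = sum (map (λ s → 𝟙 (adj? G s w)) vs)

  adjCount≡0 : ∀ {vs w} → All (λ s → ¬ Adj G s w) vs → adjCount vs w ≡ 0
  adjCount≡0 []                        = refl
  adjCount≡0 {s ∷ _} {w} (s≁w ∷ ≁w) with adj? G s w
  ... | yes s~w = contradiction s~w s≁w
  ... | no  _   = adjCount≡0 ≁w

  adjCount-++ : ∀ us vs w → adjCount (us ++ vs) w ≡ adjCount us w + adjCount vs w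
  adjCount-++ us vs w = ≡.trans (cong sum (map-++ _ us vs)) (sum-++ (map _ us) (map _ vs))

  disjointNeighbourhoods⇒adjCount≤1 : ∀ {vs} → DisjointNeighbourhoods vs → ∀ w → adjCount vs w ≤ 1
  disjointNeighbourhoods⇒adjCount≤1 []                 w = z≤n
  disjointNeighbourhoods⇒adjCount≤1 {s ∷ _} (s⇝̸ ∷ ⇝̸) w with adj? G s w
  ... | yes s~w = ≤-reflexive (cong suc (adjCount≡0 (All.map (λ s⇝̸t t~w → s⇝̸t (w , s~w , sym G t~w)) s⇝̸)))
  ... | no  _   = disjointNeighbourhoods⇒adjCount≤1 ⇝̸ w

  sum-degree≡sum-adjCount : ∀ vs → sum (map (degree G) vs) ≡ sum (map (adjCount vs) (allFin n))
  sum-degree≡sum-adjCount vs = begin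
    sum (map (degree G) vs)
      ≡⟨ cong sum (map-cong (λ s → length-filter≡sum-𝟙 (adj? G s) (allFin n)) vs) ⟩
    sum (map (λ s → sum (map (λ w → 𝟙 (adj? G s w)) (allFin n))) vs)
      ≡⟨ sum-map-comm (λ s w → 𝟙 (adj? G s w)) vs (allFin n) ⟩
    sum (map (adjCount vs) (allFin n))
      ∎
    where open ≡-Reasoning

  sum-degree≤ : ∀ vs {c} → (∀ w → adjCount vs w ≤ c) → sum (map (degree G) vs) ≤ c * n
  sum-degree≤ vs {c} adjCount≤c = begin
    sum (map (degree G) vs)            ≡⟨ sum-degree≡sum-adjCount vs ⟩
    sum (map (adjCount vs) (allFin n)) ≤⟨ sum-map-mono-≤ adjCount≤c (allFin n) ⟩
    sum (map (λ _ → c) (allFin n))     ≡⟨ sum-map-const c (allFin n) ⟩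
    length (allFin n) * c              ≡⟨ cong (_* c) (length-tabulate {n = n} id) ⟩
    n * c                              ≡⟨ *-comm n c ⟩
    c * n                              ∎
    where open ≤-Reasoning

  disjointNeighbourhoods⇒sum-degree< : ∀ {vs v} → DisjointNeighbourhoods vs →
                                       All (λ s → ¬ Adj G s v) vs → sum (map (degree G) vs) < n
  disjointNeighbourhoods⇒sum-degree< {vs} {v} disjoint ≁v = begin-strict
    sum (map (degree G) vs)            ≡⟨ sum-degree≡sum-adjCount vs ⟩
    sum (map (adjCount vs) (allFin n)) <⟨ sum-map-mono-< (disjointNeighbourhoods⇒adjCount≤1 disjoint)
                                                         (∈-allFin v) adjCount[v]<1 ⟩
    sum (map (λ _ → 1) (allFin n))     ≡⟨ sum-map-const 1 (allFin n) ⟩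
    length (allFin n) * 1              ≡⟨ *-identityʳ _ ⟩
    length (allFin n)                  ≡⟨ length-tabulate id ⟩
    n                                  ∎
    where
    open ≤-Reasoning
    adjCount[v]<1 : adjCount vs v < 1
    adjCount[v]<1 = ≤-<-trans (≤-reflexive (adjCount≡0 ≁v)) (s≤s z≤n)

  Δ+length*δ≤sum-degree : ∀ {x} → Δ G ≤ degree G x →
                          ∀ vs → Δ G + length vs * δ G ≤ sum (map (degree G) (x ∷ vs))
  Δ+length*δ≤sum-degree Δ≤degree[x] vs = +-mono-≤ Δ≤degree[x] (length*δ≤sum-degree vs)
    where
    length*δ≤sum-degree : ∀ vs → length vs * δ G ≤ sum (map (degree G) vs)
    length*δ≤sum-degree []       = z≤n
    length*δ≤sum-degree (v ∷ vs) = +-mono-≤ (δ≤degree G v) (length*δ≤sum-degree vs)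

module _ {n d D : ℕ} where

  D+2d<n⇒D+4d≤2n×D+d<n : D + 2 * d < n → D + 4 * d ≤ 2 * n × D + 1 * d < n
  D+2d<n⇒D+4d≤2n×D+d<n D+2d<n =
      ≤-trans (≤-trans (m≤m+n (D + 4 * d) D) (≤-reflexive (D+4d+D≡2[D+2d] D d)))
              (*-monoʳ-≤ 2 (<⇒≤ D+2d<n))
    , ≤-<-trans (+-monoʳ-≤ D (*-monoˡ-≤ d (n≤1+n 1))) D+2d<n
    where
    D+4d+D≡2[D+2d] : ∀ D d → D + 4 * d + D ≡ 2 * (D + 2 * d)
    D+4d+D≡2[D+2d] = solve-∀

  degreeCondition⇒¬[D+4d≤2n×D+d<n] : 2 * n < 4 * d + D ⊎ n < d + D + 1 →
                                     ¬ (D + 4 * d ≤ 2 * n × D + 1 * d < n)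
  degreeCondition⇒¬[D+4d≤2n×D+d<n] (inj₁ 2n<4d+D) (D+4d≤2n , _) =
    <⇒≱ 2n<4d+D (≤-trans (≤-reflexive (+-comm (4 * d) D)) D+4d≤2n)
  degreeCondition⇒¬[D+4d≤2n×D+d<n] (inj₂ n<d+D+1) (_ , D+d<n) =
    <⇒≱ D+d<n (m<1+n⇒m≤n (<-≤-trans n<d+D+1 (≤-reflexive (d+D+1≡1+D+1*d d D))))
    where
    d+D+1≡1+D+1*d : ∀ d D → d + D + 1 ≡ suc (D + 1 * d)
    d+D+1≡1+D+1*d = solve-∀

module _ {n} (G : Graph n) (triangleFree : TriangleFree G) where

  adjacent⇒¬Walk₂ : ∀ {u v} → Adj G u v → ¬ Walk₂ G u v
  adjacent⇒¬Walk₂ u~v (w , u~w , w~v) = triangleFree _ _ _ u~w w~v u~v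

  edge⇒adjCount≤1 : ∀ {u v} → Adj G u v → ∀ w → adjCount G (u ∷ v ∷ []) w ≤ 1
  edge⇒adjCount≤1 u~v = disjointNeighbourhoods⇒adjCount≤1 G ((adjacent⇒¬Walk₂ u~v ∷ []) ∷ [] ∷ [])

  closedWalk5⇒adjCount≤2 : ∀ {s₀ s₁ s₂ s₃ s₄} →
    Adj G s₀ s₁ → Adj G s₁ s₂ → Adj G s₂ s₃ → Adj G s₃ s₄ → Adj G s₄ s₀ →
    ∀ w → adjCount G (s₀ ∷ s₁ ∷ s₂ ∷ s₃ ∷ s₄ ∷ []) w ≤ 2
  closedWalk5⇒adjCount≤2 {s₀} {s₁} {s₂} {s₃} {s₄} e₀₁ e₁₂ e₂₃ e₃₄ e₄₀ w with adj? G s₀ w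
  ... | no _ = ≤-trans (≤-reflexive (adjCount-++ G (s₁ ∷ s₂ ∷ []) (s₃ ∷ s₄ ∷ []) w))
                       (+-mono-≤ (edge⇒adjCount≤1 e₁₂ w) (edge⇒adjCount≤1 e₃₄ w))
  ... | yes s₀~w with adj? G s₁ w | adj? G s₄ w
  ...   | yes s₁~w | _        = ⊥-elim (triangleFree _ _ _ e₀₁ s₁~w s₀~w)
  ...   | no _     | yes s₄~w = ⊥-elim (triangleFree _ _ _ e₄₀ s₀~w s₄~w)
  -- s₀ ~ w rules out s₁ and s₄, so only the edge s₂s₃ is left to contribute.
  ...   | no _     | no _     = s≤s (edge⇒adjCount≤1 e₂₃ w)

  closedWalk5⇒sum-degree≤ : ∀ {s₀ s₁ s₂ s₃ s₄} →
    Adj G s₀ s₁ → Adj G s₁ s₂ → Adj G s₂ s₃ → Adj G s₃ s₄ → Adj G s₄ s₀ →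
    sum (map (degree G) (s₀ ∷ s₁ ∷ s₂ ∷ s₃ ∷ s₄ ∷ [])) ≤ 2 * n
  closedWalk5⇒sum-degree≤ {s₀} {s₁} {s₂} {s₃} {s₄} e₀₁ e₁₂ e₂₃ e₃₄ e₄₀ =
    sum-degree≤ G (s₀ ∷ s₁ ∷ s₂ ∷ s₃ ∷ s₄ ∷ []) (closedWalk5⇒adjCount≤2 e₀₁ e₁₂ e₂₃ e₃₄ e₄₀)

  module _ {x} (Δ≤degree[x] : Δ G ≤ degree G x) {u v} (u~v : Adj G u v) where

    walk₂-to-both-ends⇒ : Walk₂ G x u → Walk₂ G x v →
                          Δ G + 4 * δ G ≤ 2 * n × Δ G + 1 * δ G < n
    walk₂-to-both-ends⇒ (a , x~a , a~u) (b , x~b , b~v) =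
        ≤-trans (Δ+length*δ≤sum-degree G Δ≤degree[x] (a ∷ u ∷ v ∷ b ∷ []))
                (closedWalk5⇒sum-degree≤ x~a a~u u~v (sym G b~v) (sym G x~b))
      , ≤-<-trans (Δ+length*δ≤sum-degree G Δ≤degree[x] (a ∷ []))
                  (disjointNeighbourhoods⇒sum-degree< G ((adjacent⇒¬Walk₂ x~a ∷ []) ∷ [] ∷ [])
                                                        (x≁v ∷ a≁v ∷ []))
      where
      x≁v : ¬ Adj G x v
      x≁v x~v = triangleFree _ _ _ x~b b~v x~v
      a≁v : ¬ Adj G a v
      a≁v a~v = triangleFree _ _ _ a~u u~v a~v

    walk₂-to-neither-end⇒ : ¬ Walk₂ G x u → ¬ Walk₂ G x v → Δ G + 2 * δ G < n
    walk₂-to-neither-end⇒ x⇝̸u x⇝̸v =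
      ≤-<-trans (Δ+length*δ≤sum-degree G Δ≤degree[x] (u ∷ v ∷ []))
                (disjointNeighbourhoods⇒sum-degree< G
                   ((x⇝̸u ∷ x⇝̸v ∷ []) ∷ (adjacent⇒¬Walk₂ u~v ∷ []) ∷ [] ∷ [])
                   (irrefl G ∷ u≁x ∷ v≁x ∷ []))
      where
      u≁x : ¬ Adj G u x
      u≁x u~x = x⇝̸v (u , sym G u~x , u~v)
      v≁x : ¬ Adj G v x
      v≁x v~x = x⇝̸u (v , sym G v~x , sym G u~v)

  walk₂-colouring-proper : ∀ {x} → Δ G ≤ degree G x →
                           ¬ (Δ G + 4 * δ G ≤ 2 * n × Δ G + 1 * δ G < n) →
                           ∀ u v → Adj G u v → does (walk₂? G x u) ≢ does (walk₂? G x v)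
  walk₂-colouring-proper {x} Δ≤degree[x] excluded u v u~v =
    does-≢ (walk₂? G x u) (walk₂? G x v)
      (λ x⇝u x⇝v → excluded (walk₂-to-both-ends⇒ Δ≤degree[x] u~v x⇝u x⇝v))
      (λ x⇝̸u x⇝̸v → excluded (D+2d<n⇒D+4d≤2n×D+d<n {n} {δ G} {Δ G}
                                (walk₂-to-neither-end⇒ Δ≤degree[x] u~v x⇝̸u x⇝̸v)))

lemma2p1 : (n : ℕ) (G : Graph n) → TriangleFree G →
    ((2 * n < 4 * δ G + Δ G) ⊎ (n < δ G + Δ G + 1)) →
    Bipartite G
lemma2p1 zero    G _            _         = (λ ()) , (λ ())
lemma2p1 (suc m) G triangleFree condition with maxDegreeVertex G
... | x , Δ≤degree[x] =
  (λ w → does (walk₂? G x w)) ,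
  walk₂-colouring-proper G triangleFree Δ≤degree[x]
    (degreeCondition⇒¬[D+4d≤2n×D+d<n] {suc m} {δ G} {Δ G} condition)
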